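{- Let $S$ be a set of $n$ positive integers whose minimum solution has size $\ell$. Let $$\Psi=\left\{\Sigma(X)\;\middle|\;X\subseteq S \text{ and } \exists\, Y\subseteq S \text{ with } X\neq Y \text{ and } \Sigma(X)=\Sigma(Y)\right\}.$$ If $\ell>\frac{n}{2}$, then $|\Psi|\ge 2^{n-\ell}$.
   Context: For a finite set $X$ of integers, $\Sigma(X)=\sum_{x\in X}x$. A solution for $S$ is a pair of disjoint nonempty subsets $A,B\subseteq S$ with $\Sigma(A)=\Sigma(B)$. A solution $(A,B)$ is a minimum solution if $|A|+|B|$ is smallest possible among all solutions; its size is $|A|+|B|$. -}

module Defs where

open import Data.Nat using (ℕ; zero; suc; _+_; _<_; _≤_)
open import Data.Bool using (Bool; true; false)
open import Data.Fin using (Fin)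
open import Data.Vec using (Vec; []; _∷_; lookup)
open import Data.Fin.Subset using (Subset; Nonempty; Empty; _∩_; ∣_∣)
open import Data.Product using (Σ; ∃; _×_)
open import Relation.Binary.PropositionalEquality using (_≡_; _≢_)

-- S is a set of n positive integers, given as a vector of n pairwise
-- distinct positive naturals; subsets of S are subsets of the index set Fin n.
IsPositiveSet : ∀ {n} → Vec ℕ n → Set
IsPositiveSet {n} S =
  (∀ (i : Fin n) → 0 < lookup S i) ×
  (∀ (i j : Fin n) → lookup S i ≡ lookup S j → i ≡ j)

sumOf : ∀ {n} → Vec ℕ n → Subset n → ℕ
sumOf [] [] = 0
sumOf (x ∷ xs) (true ∷ p) = x + sumOf xs p
sumOf (x ∷ xs) (false ∷ p) = sumOf xs p

IsSolution : ∀ {n} → Vec ℕ n → Subset n → Subset n → Set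
IsSolution S A B =
  Nonempty A × Nonempty B × Empty (A ∩ B) × sumOf S A ≡ sumOf S B

MinSolutionSize : ∀ {n} → Vec ℕ n → ℕ → Set
MinSolutionSize {n} S ℓ =
  (∃ λ (A : Subset n) → ∃ λ (B : Subset n) → IsSolution S A B × ∣ A ∣ + ∣ B ∣ ≡ ℓ) ×
  (∀ (A B : Subset n) → IsSolution S A B → ℓ ≤ ∣ A ∣ + ∣ B ∣)

InΨ : ∀ {n} → Vec ℕ n → ℕ → Set
InΨ {n} S m =
  ∃ λ (X : Subset n) → sumOf S X ≡ m × ∃ λ (Y : Subset n) → X ≢ Y × sumOf S Y ≡ m

-- Let (A , B) be a minimum solution and C the complement of A ∪ B, so |C| = n − ℓ < ℓ.
-- For every Z ⊆ C, the sets A ∪ Z ≠ B ∪ Z have the common sum Σ(A) + Σ(Z), which therefore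
-- lies in Ψ. These 2^(n−ℓ) values are pairwise distinct: if Z₁ ≠ Z₂ had equal sums, then
-- (Z₁ ∖ Z₂ , Z₂ ∖ Z₁) would be a solution of size at most |C| < ℓ.
module Submission where

open import Defs
open import Data.Bool using (true; false)
open import Data.Empty using (⊥-elim)
open import Data.Fin using (Fin; zero; suc)
open import Data.Fin.Properties using (*↔×; 2↔Bool)
open import Data.Fin.Subset
  using (Subset; Nonempty; Empty; _∈_; _⊆_; _∩_; _∪_; _─_; ∁; ⊥; ∣_∣)
open import Data.Fin.Subset.Properties
  using (drop-∷-Empty; nonempty?; _∈?_; ∉⊥; ⊆-trans; ⊆-antisym; ∩-comm; p─q⊆p; p⊆p∪q; q⊆p∪q;
         x∈p∩q⁺; x∈p∩q⁻; x∈p∪q⁻; x∈p∪q⁺; x∈p∧x∉q⇒x∈p─q; x∈∁p⇒x∉p; p⊆q⇒∣p∣≤∣q∣; ∣p∣≤n; ∣∁p∣≡n∸∣p∣)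
open import Data.Nat using (ℕ; zero; suc; _<_; _≤_; _+_; _∸_; _^_)
open import Data.Nat.Properties
  using (+-assoc; +-commutativeSemigroup; +-cancelˡ-≡; +-cancelʳ-≡; +-cancelˡ-<; m+[n∸m]≡n; m+n∸m≡n;
         ≤-trans; <⇒≱; m≤m+n; m≤n+m)
open import Data.Product using (∃; _×_; _,_)
open import Data.Sum using (inj₁; [_,_])
open import Data.Vec using (Vec; []; _∷_; lookup; replicate; here; there)
open import Data.Vec.Properties using (∷-injectiveˡ; ∷-injectiveʳ)
open import Function using (_∘_)
open import Function.Bundles using (Inverse; Injection)
open import Function.Definitions using (Injective)
open import Function.Properties.Inverse using (↔⇒↣)
open import Relation.Nullary using (yes; no)
open import Relation.Nullary.Decidable using (decidable-stable)
open import Relation.Binary.PropositionalEquality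
  using (_≡_; _≢_; refl; sym; trans; cong; cong₂; subst; module ≡-Reasoning)
open ≡-Reasoning
open import Algebra.Properties.CommutativeSemigroup +-commutativeSemigroup using (x∙yz≈y∙xz)

Positive : ∀ {n} → Vec ℕ n → Set
Positive S = ∀ i → 0 < lookup S i

SolutionsOfSizeAtLeast : ∀ {n} → Vec ℕ n → ℕ → Set
SolutionsOfSizeAtLeast {n} S ℓ = ∀ (A B : Subset n) → IsSolution S A B → ℓ ≤ ∣ A ∣ + ∣ B ∣

sumOf-∪ : ∀ {n} (S : Vec ℕ n) (P Q : Subset n) → Empty (P ∩ Q) →
  sumOf S (P ∪ Q) ≡ sumOf S P + sumOf S Q
sumOf-∪ []      []          []          _ = refl
sumOf-∪ (x ∷ S) (true ∷ P)  (true ∷ Q)  e = ⊥-elim (e (zero , here))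
sumOf-∪ (x ∷ S) (true ∷ P)  (false ∷ Q) e =
  trans (cong (x +_) (sumOf-∪ S P Q (drop-∷-Empty e))) (sym (+-assoc x (sumOf S P) _))
sumOf-∪ (x ∷ S) (false ∷ P) (true ∷ Q)  e =
  trans (cong (x +_) (sumOf-∪ S P Q (drop-∷-Empty e))) (x∙yz≈y∙xz x (sumOf S P) (sumOf S Q))
sumOf-∪ (x ∷ S) (false ∷ P) (false ∷ Q) e = sumOf-∪ S P Q (drop-∷-Empty e)

sumOf-─+sumOf-∩ : ∀ {n} (S : Vec ℕ n) (P Q : Subset n) →
  sumOf S (P ─ Q) + sumOf S (P ∩ Q) ≡ sumOf S P
sumOf-─+sumOf-∩ []      []          []          = refl
sumOf-─+sumOf-∩ (x ∷ S) (true ∷ P)  (true ∷ Q)  =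
  trans (x∙yz≈y∙xz (sumOf S (P ─ Q)) x (sumOf S (P ∩ Q))) (cong (x +_) (sumOf-─+sumOf-∩ S P Q))
sumOf-─+sumOf-∩ (x ∷ S) (true ∷ P)  (false ∷ Q) =
  trans (+-assoc x (sumOf S (P ─ Q)) _) (cong (x +_) (sumOf-─+sumOf-∩ S P Q))
sumOf-─+sumOf-∩ (x ∷ S) (false ∷ P) (true ∷ Q)  = sumOf-─+sumOf-∩ S P Q
sumOf-─+sumOf-∩ (x ∷ S) (false ∷ P) (false ∷ Q) = sumOf-─+sumOf-∩ S P Q

sumOf-─-cancel : ∀ {n} (S : Vec ℕ n) (P Q : Subset n) → sumOf S P ≡ sumOf S Q →
  sumOf S (P ─ Q) ≡ sumOf S (Q ─ P)
sumOf-─-cancel S P Q eq = +-cancelʳ-≡ (sumOf S (P ∩ Q)) _ _ (begin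
  sumOf S (P ─ Q) + sumOf S (P ∩ Q) ≡⟨ sumOf-─+sumOf-∩ S P Q ⟩
  sumOf S P                         ≡⟨ eq ⟩
  sumOf S Q                         ≡⟨ sym (sumOf-─+sumOf-∩ S Q P) ⟩
  sumOf S (Q ─ P) + sumOf S (Q ∩ P) ≡⟨ cong (λ R → sumOf S (Q ─ P) + sumOf S R) (∩-comm Q P) ⟩
  sumOf S (Q ─ P) + sumOf S (P ∩ Q) ∎)

∣p∣≡sumOf-ones : ∀ {n} (P : Subset n) → ∣ P ∣ ≡ sumOf (replicate n 1) P
∣p∣≡sumOf-ones []         = refl
∣p∣≡sumOf-ones (true ∷ P)  = cong (1 +_) (∣p∣≡sumOf-ones P)
∣p∣≡sumOf-ones (false ∷ P) = ∣p∣≡sumOf-ones P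

∣p∪q∣≡∣p∣+∣q∣ : ∀ {n} (P Q : Subset n) → Empty (P ∩ Q) → ∣ P ∪ Q ∣ ≡ ∣ P ∣ + ∣ Q ∣
∣p∪q∣≡∣p∣+∣q∣ {n} P Q e = begin
  ∣ P ∪ Q ∣                   ≡⟨ ∣p∣≡sumOf-ones (P ∪ Q) ⟩
  sumOf ones (P ∪ Q)          ≡⟨ sumOf-∪ ones P Q e ⟩
  sumOf ones P + sumOf ones Q ≡⟨ sym (cong₂ _+_ (∣p∣≡sumOf-ones P) (∣p∣≡sumOf-ones Q)) ⟩
  ∣ P ∣ + ∣ Q ∣               ∎
  where ones = replicate n 1

∣p∣+∣∁p∣≡n : ∀ {n} (P : Subset n) → ∣ P ∣ + ∣ ∁ P ∣ ≡ n
∣p∣+∣∁p∣≡n P = trans (cong (∣ P ∣ +_) (∣∁p∣≡n∸∣p∣ P)) (m+[n∸m]≡n (∣p∣≤n P))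

sumOf-positive : ∀ {n} (S : Vec ℕ n) → Positive S → (P : Subset n) → Nonempty P → 0 < sumOf S P
sumOf-positive (x ∷ S) pos (true ∷ P)  (zero , here)       = ≤-trans (pos zero) (m≤m+n x _)
sumOf-positive (x ∷ S) pos (true ∷ P)  (suc i , there i∈P) =
  ≤-trans (sumOf-positive S (pos ∘ suc) P (i , i∈P)) (m≤n+m _ x)
sumOf-positive (x ∷ S) pos (false ∷ P) (suc i , there i∈P) = sumOf-positive S (pos ∘ suc) P (i , i∈P)

sumOf-positive⇒Nonempty : ∀ {n} (S : Vec ℕ n) (P : Subset n) → 0 < sumOf S P → Nonempty P
sumOf-positive⇒Nonempty []      []          ()
sumOf-positive⇒Nonempty (x ∷ S) (true ∷ P)  _   = zero , here
sumOf-positive⇒Nonempty (x ∷ S) (false ∷ P) pos =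
  let i , i∈P = sumOf-positive⇒Nonempty S P pos in suc i , there i∈P

p─q∩q─p≡⊥ : ∀ {n} (P Q : Subset n) → (P ─ Q) ∩ (Q ─ P) ≡ ⊥
p─q∩q─p≡⊥ []          []          = refl
p─q∩q─p≡⊥ (true ∷ P)  (true ∷ Q)  = cong (false ∷_) (p─q∩q─p≡⊥ P Q)
p─q∩q─p≡⊥ (true ∷ P)  (false ∷ Q) = cong (false ∷_) (p─q∩q─p≡⊥ P Q)
p─q∩q─p≡⊥ (false ∷ P) (true ∷ Q)  = cong (false ∷_) (p─q∩q─p≡⊥ P Q)
p─q∩q─p≡⊥ (false ∷ P) (false ∷ Q) = cong (false ∷_) (p─q∩q─p≡⊥ P Q)

Empty-─ : ∀ {n} (P Q : Subset n) → Empty ((P ─ Q) ∩ (Q ─ P))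
Empty-─ P Q (i , i∈) = ∉⊥ (subst (i ∈_) (p─q∩q─p≡⊥ P Q) i∈)

Empty[p─q]⇒p⊆q : ∀ {n} {P Q : Subset n} → Empty (P ─ Q) → P ⊆ Q
Empty[p─q]⇒p⊆q {Q = Q} e {i} i∈P =
  decidable-stable (i ∈? Q) (λ i∉Q → e (i , x∈p∧x∉q⇒x∈p─q i∈P i∉Q))

∪-least : ∀ {n} {P Q R : Subset n} → P ⊆ R → Q ⊆ R → P ∪ Q ⊆ R
∪-least {P = P} {Q} P⊆R Q⊆R i∈P∪Q = [ P⊆R , Q⊆R ] (x∈p∪q⁻ P Q i∈P∪Q)

∣p─q∣+∣q─p∣≤∣r∣ : ∀ {n} {P Q R : Subset n} → P ⊆ R → Q ⊆ R → ∣ P ─ Q ∣ + ∣ Q ─ P ∣ ≤ ∣ R ∣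
∣p─q∣+∣q─p∣≤∣r∣ {P = P} {Q} P⊆R Q⊆R =
  subst (_≤ _) (∣p∪q∣≡∣p∣+∣q∣ (P ─ Q) (Q ─ P) (Empty-─ P Q))
    (p⊆q⇒∣p∣≤∣q∣ (∪-least (⊆-trans (p─q⊆p P Q) P⊆R) (⊆-trans (p─q⊆p Q P) Q⊆R)))

differences-solution : ∀ {n} (S : Vec ℕ n) → Positive S → (P Q : Subset n) →
  Nonempty (P ─ Q) → sumOf S P ≡ sumOf S Q → IsSolution S (P ─ Q) (Q ─ P)
differences-solution S pos P Q ne eq =
  ne , sumOf-positive⇒Nonempty S (Q ─ P) (subst (0 <_) sums (sumOf-positive S pos (P ─ Q) ne)) ,
  Empty-─ P Q , sums
  where
  sums : sumOf S (P ─ Q) ≡ sumOf S (Q ─ P)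
  sums = sumOf-─-cancel S P Q eq

sumOf-≢-inside-small-set : ∀ {n} (S : Vec ℕ n) {ℓ} → Positive S → SolutionsOfSizeAtLeast S ℓ →
  {C : Subset n} → ∣ C ∣ < ℓ → ∀ {P Q} → P ⊆ C → Q ⊆ C → Nonempty (P ─ Q) → sumOf S P ≢ sumOf S Q
sumOf-≢-inside-small-set S pos minimal small {P} {Q} P⊆C Q⊆C ne eq =
  <⇒≱ small (≤-trans (minimal _ _ (differences-solution S pos P Q ne eq)) (∣p─q∣+∣q─p∣≤∣r∣ P⊆C Q⊆C))

sumOf-injective-inside-small-set : ∀ {n} (S : Vec ℕ n) {ℓ} → Positive S → SolutionsOfSizeAtLeast S ℓ →
  {C : Subset n} → ∣ C ∣ < ℓ → ∀ {P Q} → P ⊆ C → Q ⊆ C → sumOf S P ≡ sumOf S Q → P ≡ Q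
sumOf-injective-inside-small-set S pos minimal small {P} {Q} P⊆C Q⊆C eq
  with nonempty? (P ─ Q) | nonempty? (Q ─ P)
... | yes ne | _      = ⊥-elim (sumOf-≢-inside-small-set S pos minimal small P⊆C Q⊆C ne eq)
... | no _   | yes ne = ⊥-elim (sumOf-≢-inside-small-set S pos minimal small Q⊆C P⊆C ne (sym eq))
... | no e   | no e′  = ⊆-antisym (Empty[p─q]⇒p⊆q e) (Empty[p─q]⇒p⊆q e′)

binary : ∀ k → Fin (2 ^ k) → Subset k
binary zero    _ = []
binary (suc k) i =
  let b , j = Inverse.to (*↔× {2} {2 ^ k}) i in Inverse.to 2↔Bool b ∷ binary k j

binary-injective : ∀ k → Injective _≡_ _≡_ (binary k)
binary-injective zero    {zero} {zero} _ = refl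
binary-injective (suc k) eq =
  Injection.injective (↔⇒↣ (*↔× {2} {2 ^ k}))
    (cong₂ _,_ (Injection.injective (↔⇒↣ 2↔Bool) (∷-injectiveˡ eq))
               (binary-injective k (∷-injectiveʳ eq)))

-- expand C W is the subset of C that W selects, C's elements being numbered in increasing order.
expand : ∀ {n} (C : Subset n) → Subset ∣ C ∣ → Subset n
expand []          _       = []
expand (true ∷ C)  (b ∷ W) = b ∷ expand C W
expand (false ∷ C) W       = false ∷ expand C W

expand-⊆ : ∀ {n} (C : Subset n) (W : Subset ∣ C ∣) → expand C W ⊆ C
expand-⊆ (true ∷ C)  (true ∷ W) here       = here
expand-⊆ (true ∷ C)  (_ ∷ W)    (there i∈) = there (expand-⊆ C W i∈)
expand-⊆ (false ∷ C) W          (there i∈) = there (expand-⊆ C W i∈)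

expand-injective : ∀ {n} (C : Subset n) → Injective _≡_ _≡_ (expand C)
expand-injective []          {[]}    {[]}    _  = refl
expand-injective (true ∷ C)  {_ ∷ _} {_ ∷ _} eq =
  cong₂ _∷_ (∷-injectiveˡ eq) (expand-injective C (∷-injectiveʳ eq))
expand-injective (false ∷ C)                 eq = expand-injective C (∷-injectiveʳ eq)

Empty-∩-⊆∁ : ∀ {n} {X Y Z : Subset n} → X ⊆ Y → Z ⊆ ∁ Y → Empty (X ∩ Z)
Empty-∩-⊆∁ {X = X} {Z = Z} X⊆Y Z⊆∁Y (i , i∈X∩Z) =
  let i∈X , i∈Z = x∈p∩q⁻ X Z i∈X∩Z in x∈∁p⇒x∉p (Z⊆∁Y i∈Z) (X⊆Y i∈X)

solution-∪-InΨ : ∀ {n} (S : Vec ℕ n) {A B Z : Subset n} → IsSolution S A B → Z ⊆ ∁ (A ∪ B) →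
  InΨ S (sumOf S A + sumOf S Z)
solution-∪-InΨ S {A} {B} {Z} ((i , i∈A) , _ , disjoint , sumA≡sumB) Z⊆∁A∪B =
  A ∪ Z , sumOf-∪ S A Z A∩Z-empty , B ∪ Z , distinct ,
  trans (sumOf-∪ S B Z (Empty-∩-⊆∁ (q⊆p∪q A B) Z⊆∁A∪B)) (cong (_+ sumOf S Z) (sym sumA≡sumB))
  where
  A∩Z-empty : Empty (A ∩ Z)
  A∩Z-empty = Empty-∩-⊆∁ (p⊆p∪q B) Z⊆∁A∪B

  distinct : A ∪ Z ≢ B ∪ Z
  distinct eq =
    [ (λ i∈B → disjoint (i , x∈p∩q⁺ (i∈A , i∈B))) , (λ i∈Z → A∩Z-empty (i , x∈p∩q⁺ (i∈A , i∈Z))) ]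
      (x∈p∪q⁻ B Z (subst (i ∈_) eq (x∈p∪q⁺ (inj₁ i∈A))))

ΨHasAtLeast : ∀ {n} → Vec ℕ n → ℕ → Set
ΨHasAtLeast S N = ∃ λ (f : Fin N → ℕ) → Injective _≡_ _≡_ f × (∀ k → InΨ S (f k))

ΨHasAtLeast-2^∣∁A∪B∣ : ∀ {n} (S : Vec ℕ n) {ℓ A B} → Positive S → SolutionsOfSizeAtLeast S ℓ →
  IsSolution S A B → ∣ ∁ (A ∪ B) ∣ < ℓ → ΨHasAtLeast S (2 ^ ∣ ∁ (A ∪ B) ∣)
ΨHasAtLeast-2^∣∁A∪B∣ S {A = A} {B} pos minimal sol small =
  f , f-injective , λ k → solution-∪-InΨ S sol (expand-⊆ C (binary _ k))
  where
  C = ∁ (A ∪ B)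

  f : Fin (2 ^ ∣ C ∣) → ℕ
  f k = sumOf S A + sumOf S (expand C (binary _ k))

  f-injective : Injective _≡_ _≡_ f
  f-injective eq =
    binary-injective _ (expand-injective C
      (sumOf-injective-inside-small-set S pos minimal small (expand-⊆ C _) (expand-⊆ C _)
        (+-cancelˡ-≡ (sumOf S A) _ _ eq)))

lemma2 : ∀ (n : ℕ) (S : Vec ℕ n) (ℓ : ℕ) → IsPositiveSet S → MinSolutionSize S ℓ →
    n < ℓ + ℓ →
    ∃ λ (f : Fin (2 ^ (n ∸ ℓ)) → ℕ) → Injective _≡_ _≡_ f × (∀ k → InΨ S (f k))
lemma2 n S ℓ (pos , _) ((A , B , sol@(_ , _ , disjoint , _) , size) , minimal) n<ℓ+ℓ =
  subst (λ m → ΨHasAtLeast S (2 ^ m)) (sym n∸ℓ≡∣C∣)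
    (ΨHasAtLeast-2^∣∁A∪B∣ S pos minimal sol ∣C∣<ℓ)
  where
  ℓ+∣C∣≡n : ℓ + ∣ ∁ (A ∪ B) ∣ ≡ n
  ℓ+∣C∣≡n = trans (cong (_+ _) (trans (sym size) (sym (∣p∪q∣≡∣p∣+∣q∣ A B disjoint))))
                  (∣p∣+∣∁p∣≡n (A ∪ B))

  n∸ℓ≡∣C∣ : n ∸ ℓ ≡ ∣ ∁ (A ∪ B) ∣
  n∸ℓ≡∣C∣ = trans (cong (_∸ ℓ) (sym ℓ+∣C∣≡n)) (m+n∸m≡n ℓ _)

  ∣C∣<ℓ : ∣ ∁ (A ∪ B) ∣ < ℓ
  ∣C∣<ℓ = +-cancelˡ-< ℓ _ _ (subst (_< ℓ + ℓ) (sym ℓ+∣C∣≡n) n<ℓ+ℓ)
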